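{- For every spine $\mathbf{s}$ in $\{0,\ldots,n-1\}^k$ and every $j\in\{0,\ldots,(n-1)k\}$, the multi-dimensional herringbone function $h^{\mathbf{s},j}$ is monotone, i.e. $v\le w$ implies $h^{\mathbf{s},j}(v)\le h^{\mathbf{s},j}(w)$.
   Context: Order $\{0,\ldots,n-1\}^k$ componentwise; $a<b$ means $a\le b$ and $a\ne b$. A spine is a sequence $\mathbf{s}=(s^0,\ldots,s^{(n-1)k})$ of vertices with $s^0=(0,\ldots,0)$, $s^{(n-1)k}=(n-1,\ldots,n-1)$ and $s^{i+1}>s^i$ for all $i$. Define $M(v)=\min\{i\in\{0,\ldots,(n-1)k\}: s^i\ge v\}$, $\mu(v)=\max\{i: s^i\le v\}$, and $h^{\mathbf{s},j}(v)=v$ if $v=s^j$; $s^{i+1}$ if $v=s^i$, $i<j$; $s^{i-1}$ if $v=s^i$, $i>j$; and $v+(s^{\mu(v)+1}-s^{\mu(v)})-(s^{M(v)}-s^{M(v)-1})$ otherwise. -}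

module Defs where

open import Data.Nat using (ℕ; zero; suc; _+_; _*_; _∸_; _≤_; _<_)
open import Data.Nat.Properties using (<-cmp)
import Data.Nat.Properties as ℕP
open import Data.Bool using (Bool; if_then_else_)
open import Data.Vec using (Vec; replicate; zipWith; _∷_; [])
open import Data.Vec.Relation.Binary.Pointwise.Inductive as PW using (Pointwise)
open import Data.Vec.Relation.Unary.All using (All)
open import Data.Vec.Properties using (≡-dec)
open import Data.Product using (_×_)
open import Relation.Binary.PropositionalEquality using (_≡_; _≢_)
open import Relation.Binary.Definitions using (tri<; tri≈; tri>)
open import Relation.Nullary using (yes; no)
open import Relation.Nullary.Decidable using (⌊_⌋)

-- Vertices of {0,…,n-1}^k are represented as vectors in ℕ^k whose entries are < n.
Vertex : ℕ → Set
Vertex k = Vec ℕ k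

InCube : ∀ {k} → ℕ → Vertex k → Set
InCube n v = All (_< n) v

_≤ᵥ_ : ∀ {k} → Vertex k → Vertex k → Set
v ≤ᵥ w = Pointwise _≤_ v w

_<ᵥ_ : ∀ {k} → Vertex k → Vertex k → Set
v <ᵥ w = v ≤ᵥ w × v ≢ w

_≤ᵥ?_ : ∀ {k} (v w : Vertex k) → Relation.Nullary.Dec (v ≤ᵥ w)
v ≤ᵥ? w = PW.decidable ℕP._≤?_ v w

_≟ᵥ_ : ∀ {k} (v w : Vertex k) → Relation.Nullary.Dec (v ≡ w)
_≟ᵥ_ = ≡-dec ℕP._≟_

len : ℕ → ℕ → ℕ
len n k = (n ∸ 1) * k

-- A spine is given as a sequence ℕ → Vertex k; only the indices 0,…,(n-1)k matter.
record IsSpine (n k : ℕ) (s : ℕ → Vertex k) : Set where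
  field
    inCube : ∀ i → i ≤ len n k → InCube n (s i)
    start  : s 0 ≡ replicate k 0
    end    : s (len n k) ≡ replicate k (n ∸ 1)
    step   : ∀ i → i < len n k → s i <ᵥ s (suc i)

-- least i ≤ m with P i (returns m if there is none)
firstUpTo : (ℕ → Bool) → ℕ → ℕ
firstUpTo P zero = zero
firstUpTo P (suc m) = if P (firstUpTo P m) then firstUpTo P m else suc m

-- greatest i ≤ m with P i (returns 0 if there is none)
lastUpTo : (ℕ → Bool) → ℕ → ℕ
lastUpTo P zero = zero
lastUpTo P (suc m) = if P (suc m) then suc m else lastUpTo P m

module _ (n k : ℕ) (s : ℕ → Vertex k) where

  M : Vertex k → ℕ
  M v = firstUpTo (λ i → ⌊ v ≤ᵥ? s i ⌋) (len n k)

  μ : Vertex k → ℕ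
  μ v = lastUpTo (λ i → ⌊ s i ≤ᵥ? v ⌋) (len n k)

  -- index of v on the spine, if any (checked by the test s (spineIdx v) ≟ v)
  spineIdx : Vertex k → ℕ
  spineIdx v = firstUpTo (λ i → ⌊ s i ≟ᵥ v ⌋) (len n k)

  -- componentwise v + (a - b) in ℕ (for off-spine v this subtraction is exact)
  _⊕_ : Vertex k → Vertex k → Vertex k
  _⊕_ = zipWith _+_
  _⊖_ : Vertex k → Vertex k → Vertex k
  _⊖_ = zipWith _∸_

  herringbone : ℕ → Vertex k → Vertex k
  herringbone j v with s (spineIdx v) ≟ᵥ v
  ... | yes _ with <-cmp (spineIdx v) j
  ...   | tri< _ _ _ = s (suc (spineIdx v))
  ...   | tri≈ _ _ _ = v
  ...   | tri> _ _ _ = s (spineIdx v ∸ 1)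
  herringbone j v | no _ =
    (v ⊕ (s (suc (μ v)) ⊖ s (μ v))) ⊖ (s (M v) ⊖ s (M v ∸ 1))

module Submission where

-- The coordinate sum climbs from 0 to (n-1)k in (n-1)k strict steps, so it equals the index on the
-- spine and consecutive spine vertices differ by a unit vector. On the spine, h moves one step
-- towards s^j, which is monotone in the index. An off-spine x lies between s^μ and s^M with
-- μ + 1 < M; it agrees with s^μ in the direction of step μ and with s^M in the direction of
-- step M - 1, so h(x), which raises the first and lowers the second, satisfies
-- s^(μ+1) ≤ h(x) ≤ s^(M-1). These bounds compare on- and off-spine vertices; two off-spine
-- vertices v ≤ w are compared coordinatewise using μ(v) ≤ μ(w) and M(v) ≤ M(w).

open import Defs
open import Data.Bool using (Bool; true; false; T)
open import Data.Empty using (⊥-elim)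
open import Data.Fin using (Fin; zero; suc; _≟_)
open import Data.Nat using (ℕ; zero; suc; _+_; _*_; _∸_; _≤_; _<_; z≤n; s≤s)
open import Data.Nat.Properties
  using ( ≤-refl; ≤-reflexive; ≤-trans; ≤-antisym; <-trans; ≤-<-trans; <-≤-trans; <-irrefl; <⇒≤
        ; ≤-pred; n≤1+n; m≤n⇒m≤1+n; m≤n⇒m<n∨m≡n; m≤n+m; module ≤-Reasoning; ≤∧≢⇒<; <⇒≤pred; 1+n≰n
        ; +-mono-≤; +-monoˡ-≤; +-monoʳ-≤; +-cancelˡ-≤; +-cancelʳ-≤; +-cancelˡ-≡; +-suc; +-identityʳ; +-comm
        ; m∸n≤m; ∸-monoˡ-≤; n∸n≡0; _<?_; ≮⇒≥; m+n∸n≡m; m+[n∸m]≡n; *-comm; <-cmp)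
open import Data.Product using (_,_; proj₁)
open import Data.Sum using (_⊎_; inj₁; inj₂)
open import Data.Vec using ([]; _∷_; lookup; sum; replicate; zipWith)
open import Data.Vec.Properties using (lookup-zipWith)
import Data.Vec.Relation.Binary.Pointwise.Inductive as Pointwise
open import Data.Vec.Relation.Binary.Pointwise.Inductive using ([]; _∷_)
open import Data.Vec.Relation.Binary.Pointwise.Extensional using (ext; extensional⇒inductive)
open import Data.Vec.Relation.Unary.All using ([]; _∷_)
open import Relation.Binary.Definitions using (tri<; tri≈; tri>)
open import Relation.Binary.PropositionalEquality
open import Relation.Nullary using (yes; no)
open import Relation.Nullary.Decidable using (⌊_⌋; toWitness; fromWitness)

module _ (P : ℕ → Bool) where

  firstUpTo-≤ : ∀ m → firstUpTo P m ≤ m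
  firstUpTo-≤ zero = z≤n
  firstUpTo-≤ (suc m) with P (firstUpTo P m)
  ... | true  = m≤n⇒m≤1+n (firstUpTo-≤ m)
  ... | false = ≤-refl

  firstUpTo-holds : ∀ m {i} → i ≤ m → T (P i) → T (P (firstUpTo P m))
  firstUpTo-holds zero    z≤n Pi = Pi
  firstUpTo-holds (suc m) i≤ Pi with P (firstUpTo P m) in eq
  ... | true  = subst T (sym eq) _
  ... | false with m≤n⇒m<n∨m≡n i≤
  ...   | inj₂ refl = Pi
  ...   | inj₁ i<   = ⊥-elim (subst T eq (firstUpTo-holds m (≤-pred i<) Pi))

  firstUpTo-least : ∀ m {i} → i ≤ m → T (P i) → firstUpTo P m ≤ i
  firstUpTo-least zero    z≤n _  = z≤n
  firstUpTo-least (suc m) i≤ Pi with P (firstUpTo P m) in eq | m≤n⇒m<n∨m≡n i≤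
  ... | true  | inj₁ i<   = firstUpTo-least m (≤-pred i<) Pi
  ... | true  | inj₂ refl = m≤n⇒m≤1+n (firstUpTo-≤ m)
  ... | false | inj₁ i<   = ⊥-elim (subst T eq (firstUpTo-holds m (≤-pred i<) Pi))
  ... | false | inj₂ refl = ≤-refl

  lastUpTo-≤ : ∀ m → lastUpTo P m ≤ m
  lastUpTo-≤ zero = z≤n
  lastUpTo-≤ (suc m) with P (suc m)
  ... | true  = ≤-refl
  ... | false = m≤n⇒m≤1+n (lastUpTo-≤ m)

  lastUpTo-holds : ∀ m → T (P 0) → T (P (lastUpTo P m))
  lastUpTo-holds zero    P0 = P0
  lastUpTo-holds (suc m) P0 with P (suc m) in eq
  ... | true  = subst T (sym eq) _
  ... | false = lastUpTo-holds m P0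

  lastUpTo-greatest : ∀ m {i} → i ≤ m → T (P i) → i ≤ lastUpTo P m
  lastUpTo-greatest zero    z≤n _ = z≤n
  lastUpTo-greatest (suc m) i≤ Pi with P (suc m) in eq | m≤n⇒m<n∨m≡n i≤
  ... | true  | _         = i≤
  ... | false | inj₁ i<   = lastUpTo-greatest m (≤-pred i<) Pi
  ... | false | inj₂ refl = ⊥-elim (subst T eq Pi)

private
  variable
    k : ℕ

≤ᵥ-refl : {v : Vertex k} → v ≤ᵥ v
≤ᵥ-refl = Pointwise.refl ≤-refl

≤ᵥ-trans : {u v w : Vertex k} → u ≤ᵥ v → v ≤ᵥ w → u ≤ᵥ w
≤ᵥ-trans = Pointwise.trans ≤-trans

≤ᵥ-antisym : {v w : Vertex k} → v ≤ᵥ w → w ≤ᵥ v → v ≡ w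
≤ᵥ-antisym []       []       = refl
≤ᵥ-antisym (p ∷ ps) (q ∷ qs) = cong₂ _∷_ (≤-antisym p q) (≤ᵥ-antisym ps qs)

≤ᵥ-lookup : {v w : Vertex k} → v ≤ᵥ w → ∀ c → lookup v c ≤ lookup w c
≤ᵥ-lookup = Pointwise.lookup

lookup⇒≤ᵥ : {v w : Vertex k} → (∀ c → lookup v c ≤ lookup w c) → v ≤ᵥ w
lookup⇒≤ᵥ f = extensional⇒inductive (ext f)

sum-mono-≤ᵥ : {v w : Vertex k} → v ≤ᵥ w → sum v ≤ sum w
sum-mono-≤ᵥ []       = z≤n
sum-mono-≤ᵥ (p ∷ ps) = +-mono-≤ p (sum-mono-≤ᵥ ps)

≤ᵥ∧sum≥⇒≡ : {v w : Vertex k} → v ≤ᵥ w → sum w ≤ sum v → v ≡ w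
≤ᵥ∧sum≥⇒≡ [] _ = refl
≤ᵥ∧sum≥⇒≡ {v = x ∷ v} {y ∷ w} (x≤y ∷ v≤w) Σw≤Σv = cong₂ _∷_
  (≤-antisym x≤y (+-cancelʳ-≤ (sum w) y x (≤-trans Σw≤Σv (+-monoʳ-≤ x (sum-mono-≤ᵥ v≤w)))))
  (≤ᵥ∧sum≥⇒≡ v≤w (+-cancelˡ-≤ y (sum w) (sum v) (≤-trans Σw≤Σv (+-monoˡ-≤ (sum v) x≤y))))

<ᵥ⇒sum< : {v w : Vertex k} → v <ᵥ w → sum v < sum w
<ᵥ⇒sum< (v≤w , v≢w) =
  ≤∧≢⇒< (sum-mono-≤ᵥ v≤w) (λ Σv≡Σw → v≢w (≤ᵥ∧sum≥⇒≡ v≤w (≤-reflexive (sym Σv≡Σw))))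

record _⋖_ {k : ℕ} (u w : Vertex k) : Set where
  field
    dir     : Fin k
    at-dir  : lookup w dir ≡ suc (lookup u dir)
    off-dir : ∀ c → c ≢ dir → lookup w c ≡ lookup u c

open _⋖_

⋖-here : ∀ x (v : Vertex k) → (x ∷ v) ⋖ (suc x ∷ v)
⋖-here x v = record
  { dir = zero ; at-dir = refl
  ; off-dir = λ { zero c≢0 → ⊥-elim (c≢0 refl) ; (suc c) _ → refl } }

⋖-there : ∀ x {v w : Vertex k} → v ⋖ w → (x ∷ v) ⋖ (x ∷ w)
⋖-there x v⋖w = record
  { dir = suc (dir v⋖w) ; at-dir = at-dir v⋖w
  ; off-dir = λ { zero _ → refl ; (suc c) c≢ → off-dir v⋖w c (λ c≡ → c≢ (cong suc c≡)) } }

≤ᵥ∧sum≡1+sum⇒⋖ : {v w : Vertex k} → v ≤ᵥ w → sum w ≡ suc (sum v) → v ⋖ w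
≤ᵥ∧sum≡1+sum⇒⋖ {v = x ∷ v} {y ∷ w} (x≤y ∷ v≤w) Σ≡ with m≤n⇒m<n∨m≡n x≤y
... | inj₂ refl = ⋖-there x (≤ᵥ∧sum≡1+sum⇒⋖ v≤w (+-cancelˡ-≡ x _ _ (trans Σ≡ (sym (+-suc x (sum v))))))
... | inj₁ x<y  = subst ((x ∷ v) ⋖_) (≤ᵥ∧sum≥⇒≡ (x<y ∷ v≤w) (≤-reflexive Σ≡)) (⋖-here x v)

⋖-above : ∀ {u v w : Vertex k} (u⋖w : u ⋖ w) → u ≤ᵥ v →
          lookup u (dir u⋖w) < lookup v (dir u⋖w) → w ≤ᵥ v
⋖-above {v = v} {w} u⋖w u≤v u<v = lookup⇒≤ᵥ bound
  where
  bound : ∀ c → lookup w c ≤ lookup v c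
  bound c with c ≟ dir u⋖w
  ... | yes refl = ≤-trans (≤-reflexive (at-dir u⋖w)) u<v
  ... | no  c≢d  = ≤-trans (≤-reflexive (off-dir u⋖w c c≢d)) (≤ᵥ-lookup u≤v c)

⋖-below : ∀ {u v w : Vertex k} (u⋖w : u ⋖ w) → v ≤ᵥ w →
          lookup v (dir u⋖w) < lookup w (dir u⋖w) → v ≤ᵥ u
⋖-below {u = u} {v} u⋖w v≤w v<w = lookup⇒≤ᵥ bound
  where
  bound : ∀ c → lookup v c ≤ lookup u c
  bound c with c ≟ dir u⋖w
  ... | yes refl = ≤-pred (≤-trans v<w (≤-reflexive (at-dir u⋖w)))
  ... | no  c≢d  = ≤-trans (≤ᵥ-lookup v≤w c) (≤-reflexive (off-dir u⋖w c c≢d))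

⋖-interval : ∀ {u v w : Vertex k} → u ⋖ w → u ≤ᵥ v → v ≤ᵥ w → v ≡ u ⊎ v ≡ w
⋖-interval {u = u} {v} {w} u⋖w u≤v v≤w with lookup u (dir u⋖w) <? lookup v (dir u⋖w)
... | yes u<v = inj₂ (≤ᵥ-antisym v≤w (⋖-above u⋖w u≤v u<v))
... | no  u≮v = inj₁ (≤ᵥ-antisym (⋖-below u⋖w v≤w v<w) u≤v)
  where
  v<w : lookup v (dir u⋖w) < lookup w (dir u⋖w)
  v<w = ≤-trans (s≤s (≮⇒≥ u≮v)) (≤-reflexive (sym (at-dir u⋖w)))

⋖-∸-dir : ∀ {u w : Vertex k} (u⋖w : u ⋖ w) → lookup w (dir u⋖w) ∸ lookup u (dir u⋖w) ≡ 1
⋖-∸-dir {u = u} u⋖w rewrite at-dir u⋖w = m+n∸n≡m 1 (lookup u (dir u⋖w))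

⋖-∸-off : ∀ {u w : Vertex k} (u⋖w : u ⋖ w) c → c ≢ dir u⋖w → lookup w c ∸ lookup u c ≡ 0
⋖-∸-off {u = u} u⋖w c c≢d rewrite off-dir u⋖w c c≢d = n∸n≡0 (lookup u c)

sum-replicate : ∀ m x → sum (replicate m x) ≡ m * x
sum-replicate zero    x = refl
sum-replicate (suc m) x = cong (x +_) (sum-replicate m x)

replicate-0-≤ᵥ : (v : Vertex k) → replicate k 0 ≤ᵥ v
replicate-0-≤ᵥ []      = []
replicate-0-≤ᵥ (_ ∷ v) = z≤n ∷ replicate-0-≤ᵥ v

InCube⇒≤ᵥ-replicate : ∀ {n} {v : Vertex k} → InCube n v → v ≤ᵥ replicate k (n ∸ 1)
InCube⇒≤ᵥ-replicate []           = []
InCube⇒≤ᵥ-replicate (x<n ∷ v<n) = <⇒≤pred x<n ∷ InCube⇒≤ᵥ-replicate v<n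

data StepToward (j p : ℕ) : ℕ → Set where
  forward  : p < j → StepToward j p (suc p)
  stay     : p ≡ j → StepToward j p p
  backward : j < p → StepToward j p (p ∸ 1)

module _ {j : ℕ} where

  stepToward-mono : ∀ {p p' q q'} → StepToward j p q → StepToward j p' q' → p ≤ p' → q ≤ q'
  stepToward-mono (forward _)    (forward _)    p≤p' = s≤s p≤p'
  stepToward-mono (forward p<j)  (stay refl)    _    = p<j
  stepToward-mono (forward p<j)  (backward j<p') _   = <⇒≤pred (≤-<-trans p<j j<p')
  stepToward-mono (stay refl)    (forward _)    p≤p' = m≤n⇒m≤1+n p≤p'
  stepToward-mono (stay refl)    (stay refl)    p≤p' = p≤p'
  stepToward-mono (stay refl)    (backward j<p') _   = <⇒≤pred j<p'
  stepToward-mono (backward j<p) (forward p'<j) p≤p' = ⊥-elim (<-irrefl refl (<-trans j<p (≤-<-trans p≤p' p'<j)))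
  stepToward-mono (backward j<p) (stay refl)    p≤p' = ⊥-elim (<-irrefl refl (<-≤-trans j<p p≤p'))
  stepToward-mono (backward _)   (backward _)   p≤p' = ∸-monoˡ-≤ 1 p≤p'

  stepToward-≤ : ∀ {L p q} → j ≤ L → p ≤ L → StepToward j p q → q ≤ L
  stepToward-≤ j≤L _   (forward p<j) = ≤-trans p<j j≤L
  stepToward-≤ _   p≤L (stay _)      = p≤L
  stepToward-≤ _   p≤L (backward _)  = ≤-trans (m∸n≤m _ 1) p≤L

  stepToward-≤-suc : ∀ {p q} → StepToward j p q → q ≤ suc p
  stepToward-≤-suc (forward _)  = ≤-refl
  stepToward-≤-suc (stay _)     = n≤1+n _
  stepToward-≤-suc (backward _) = ≤-trans (m∸n≤m _ 1) (n≤1+n _)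

  pred-≤-stepToward : ∀ {p q} → StepToward j p q → p ∸ 1 ≤ q
  pred-≤-stepToward (forward _)  = ≤-trans (m∸n≤m _ 1) (n≤1+n _)
  pred-≤-stepToward (stay _)     = m∸n≤m _ 1
  pred-≤-stepToward (backward _) = ≤-refl

module Spine {n k : ℕ} {s : ℕ → Vertex k} (spine : IsSpine n k s) where
  open IsSpine spine

  L : ℕ
  L = len n k

  spine-mono : ∀ {i i'} → i ≤ i' → i' ≤ L → s i ≤ᵥ s i'
  spine-mono {i' = zero}   z≤n  _     = ≤ᵥ-refl
  spine-mono {i' = suc i'} i≤1+i' i'<L with m≤n⇒m<n∨m≡n i≤1+i'
  ... | inj₁ i≤i' = ≤ᵥ-trans (spine-mono (≤-pred i≤i') (<⇒≤ i'<L)) (proj₁ (step i' i'<L))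
  ... | inj₂ refl = ≤ᵥ-refl

  spine-0-≤ᵥ : ∀ v → s 0 ≤ᵥ v
  spine-0-≤ᵥ v = subst (_≤ᵥ v) (sym start) (replicate-0-≤ᵥ v)

  ≤ᵥ-spine-L : ∀ {v} → InCube n v → v ≤ᵥ s L
  ≤ᵥ-spine-L v∈ = subst (_ ≤ᵥ_) (sym end) (InCube⇒≤ᵥ-replicate v∈)

  sum-spine-increase : ∀ d i → i + d ≤ L → sum (s i) + d ≤ sum (s (i + d))
  sum-spine-increase zero i _
    rewrite +-identityʳ i | +-identityʳ (sum (s i)) = ≤-refl
  sum-spine-increase (suc d) i i+1+d≤L = begin
    sum (s i) + suc d       ≡⟨ +-suc (sum (s i)) d ⟩
    suc (sum (s i) + d)     ≤⟨ s≤s (sum-spine-increase d i (<⇒≤ i+d<L)) ⟩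
    suc (sum (s (i + d)))   ≤⟨ <ᵥ⇒sum< (step (i + d) i+d<L) ⟩
    sum (s (suc (i + d)))   ≡⟨ cong (λ i' → sum (s i')) (+-suc i d) ⟨
    sum (s (i + suc d))     ∎
    where
    open ≤-Reasoning
    i+d<L : i + d < L
    i+d<L = subst (_≤ L) (+-suc i d) i+1+d≤L

  sum-spine : ∀ {i} → i ≤ L → sum (s i) ≡ i
  sum-spine {i} i≤L = ≤-antisym (+-cancelʳ-≤ (L ∸ i) (sum (s i)) i upper) lower
    where
    open ≤-Reasoning
    lower : i ≤ sum (s i)
    lower = ≤-trans (m≤n+m i (sum (s 0))) (sum-spine-increase i 0 i≤L)
    upper : sum (s i) + (L ∸ i) ≤ i + (L ∸ i)
    upper = begin
      sum (s i) + (L ∸ i)     ≤⟨ sum-spine-increase (L ∸ i) i (≤-reflexive (m+[n∸m]≡n i≤L)) ⟩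
      sum (s (i + (L ∸ i)))   ≡⟨ cong (λ i' → sum (s i')) (m+[n∸m]≡n i≤L) ⟩
      sum (s L)               ≡⟨ cong sum end ⟩
      sum (replicate k (n ∸ 1)) ≡⟨ sum-replicate k (n ∸ 1) ⟩
      k * (n ∸ 1)             ≡⟨ *-comm k (n ∸ 1) ⟩
      L                       ≡⟨ m+[n∸m]≡n i≤L ⟨
      i + (L ∸ i)             ∎

  spine-⋖ : ∀ {i} → i < L → s i ⋖ s (suc i)
  spine-⋖ {i} i<L = ≤ᵥ∧sum≡1+sum⇒⋖ (proj₁ (step i i<L))
    (trans (sum-spine i<L) (cong suc (sym (sum-spine (<⇒≤ i<L)))))

  spine-index-mono : ∀ {i i'} → i ≤ L → i' ≤ L → s i ≤ᵥ s i' → i ≤ i'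
  spine-index-mono i≤L i'≤L s[i]≤s[i'] =
    subst₂ _≤_ (sum-spine i≤L) (sum-spine i'≤L) (sum-mono-≤ᵥ s[i]≤s[i'])

  herringboneOff : Vertex k → Vertex k
  herringboneOff v =
    zipWith _∸_ (zipWith _+_ v (zipWith _∸_ (s (suc (μ n k s v))) (s (μ n k s v))))
                (zipWith _∸_ (s (M n k s v)) (s (M n k s v ∸ 1)))

  data View (j : ℕ) (v : Vertex k) : Vertex k → Set where
    onSpine  : ∀ {p q} → p ≤ L → s p ≡ v → StepToward j p q → View j v (s q)
    offSpine : (∀ i → i ≤ L → s i ≢ v) → View j v (herringboneOff v)

  view : ∀ j v → View j v (herringbone n k s j v)
  view j v with s (spineIdx n k s v) ≟ᵥ v
  ... | no s[idx]≢v = offSpine λ i i≤L s[i]≡v →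
    s[idx]≢v (toWitness (firstUpTo-holds (λ i → ⌊ s i ≟ᵥ v ⌋) L i≤L (fromWitness s[i]≡v)))
  ... | yes s[idx]≡v with <-cmp (spineIdx n k s v) j
  ...   | tri< idx<j _ _ = onSpine (firstUpTo-≤ _ L) s[idx]≡v (forward idx<j)
  ...   | tri≈ _ idx≡j _ = subst (View j v) s[idx]≡v (onSpine (firstUpTo-≤ _ L) s[idx]≡v (stay idx≡j))
  ...   | tri> _ _ j<idx = onSpine (firstUpTo-≤ _ L) s[idx]≡v (backward j<idx)

  module _ {x : Vertex k} where

    μ-≤ : μ n k s x ≤ L
    μ-≤ = lastUpTo-≤ _ L

    spine-μ-≤ᵥ : s (μ n k s x) ≤ᵥ x
    spine-μ-≤ᵥ = toWitness (lastUpTo-holds (λ i → ⌊ s i ≤ᵥ? x ⌋) L (fromWitness (spine-0-≤ᵥ x)))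

    μ-greatest : ∀ {i} → i ≤ L → s i ≤ᵥ x → i ≤ μ n k s x
    μ-greatest i≤L s[i]≤x = lastUpTo-greatest (λ i → ⌊ s i ≤ᵥ? x ⌋) L i≤L (fromWitness s[i]≤x)

    M-≤ : M n k s x ≤ L
    M-≤ = firstUpTo-≤ _ L

    ≤ᵥ-spine-M : InCube n x → x ≤ᵥ s (M n k s x)
    ≤ᵥ-spine-M x∈ = toWitness (firstUpTo-holds (λ i → ⌊ x ≤ᵥ? s i ⌋) L ≤-refl (fromWitness (≤ᵥ-spine-L x∈)))

    M-least : ∀ {i} → i ≤ L → x ≤ᵥ s i → M n k s x ≤ i
    M-least i≤L x≤s[i] = firstUpTo-least (λ i → ⌊ x ≤ᵥ? s i ⌋) L i≤L (fromWitness x≤s[i])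

  off-spine-gap : ∀ {x i i'} → (∀ l → l ≤ L → s l ≢ x) → i ≤ L → i' ≤ L →
                  s i ≤ᵥ x → x ≤ᵥ s i' → suc i < i'
  off-spine-gap {i = i} {i'} x∉s i≤L i'≤L s[i]≤x x≤s[i'] with <-cmp (suc i) i'
  ... | tri< 1+i<i' _ _ = 1+i<i'
  ... | tri> _ _ i'<1+i =
    ⊥-elim (x∉s i' i'≤L (≤ᵥ-antisym (≤ᵥ-trans (spine-mono (≤-pred i'<1+i) i≤L) s[i]≤x) x≤s[i']))
  ... | tri≈ _ refl _ with ⋖-interval (spine-⋖ i'≤L) s[i]≤x x≤s[i']
  ...   | inj₁ x≡s[i]   = ⊥-elim (x∉s i i≤L (sym x≡s[i]))
  ...   | inj₂ x≡s[1+i] = ⊥-elim (x∉s i' i'≤L (sym x≡s[1+i]))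

  Δ : ℕ → Fin k → ℕ
  Δ i c = lookup (s (suc i)) c ∸ lookup (s i) c

  lookup-herringboneOff : ∀ {x hi} c → M n k s x ≡ suc hi →
    lookup (herringboneOff x) c ≡ lookup x c + Δ (μ n k s x) c ∸ Δ hi c
  lookup-herringboneOff {x} {hi} c M≡1+hi = begin
    lookup (zipWith _∸_ (zipWith _+_ x (δ lo)) δM) c
      ≡⟨ lookup-zipWith _∸_ c (zipWith _+_ x (δ lo)) δM ⟩
    lookup (zipWith _+_ x (δ lo)) c ∸ lookup δM c
      ≡⟨ cong₂ _∸_ (lookup-zipWith _+_ c x (δ lo)) (cong (λ i → lookup (zipWith _∸_ (s i) (s (i ∸ 1))) c) M≡1+hi) ⟩
    lookup x c + lookup (δ lo) c ∸ lookup (δ hi) c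
      ≡⟨ cong₂ (λ a b → lookup x c + a ∸ b) (lookup-δ lo) (lookup-δ hi) ⟩
    lookup x c + Δ lo c ∸ Δ hi c
      ∎
    where
    open ≡-Reasoning
    lo : ℕ
    lo = μ n k s x
    δ : ℕ → Vertex k
    δ i = zipWith _∸_ (s (suc i)) (s i)
    δM : Vertex k
    δM = zipWith _∸_ (s (M n k s x)) (s (M n k s x ∸ 1))
    lookup-δ : ∀ i → lookup (δ i) c ≡ Δ i c
    lookup-δ i = lookup-zipWith _∸_ c (s (suc i)) (s i)

  -- For off-spine x with μ(x) = lo and M(x) = hi + 1, coordinate c of h(x) is raised if c is the
  -- direction of step lo, lowered if it is the direction of step hi, and kept otherwise.
  data OffSpineCoord (x : Vertex k) (lo hi : ℕ) (c : Fin k) : ℕ → Set where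
    raised  : suc (lookup x c) ≡ lookup (s (suc lo)) c →
              OffSpineCoord x lo hi c (suc (lookup x c))
    lowered : lookup x c ≡ suc (lookup (s hi) c) →
              OffSpineCoord x lo hi c (lookup (s hi) c)
    kept    : lookup (s (suc lo)) c ≤ lookup x c → lookup x c ≤ lookup (s hi) c →
              OffSpineCoord x lo hi c (lookup x c)

  module _ {x : Vertex k} {lo hi : ℕ} {c : Fin k} where

    offSpineCoord-≤-suc : ∀ {y} → OffSpineCoord x lo hi c y → y ≤ suc (lookup x c)
    offSpineCoord-≤-suc (raised _)   = ≤-refl
    offSpineCoord-≤-suc (lowered x≡) = ≤-trans (n≤1+n _) (≤-trans (≤-reflexive (sym x≡)) (n≤1+n _))
    offSpineCoord-≤-suc (kept _ _)   = n≤1+n _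

    offSpineCoord-≤ : ∀ {y z} → OffSpineCoord x lo hi c y →
                      lookup x c ≤ z → lookup (s (suc lo)) c ≤ z → y ≤ z
    offSpineCoord-≤ (raised x≡)  _      s≤z = ≤-trans (≤-reflexive x≡) s≤z
    offSpineCoord-≤ (lowered x≡) x≤z    _   = ≤-trans (≤-trans (n≤1+n _) (≤-reflexive (sym x≡))) x≤z
    offSpineCoord-≤ (kept _ _)   x≤z    _   = x≤z

    offSpineCoord-≤-spine : ∀ {y} → lo < hi → hi ≤ L → OffSpineCoord x lo hi c y → y ≤ lookup (s hi) c
    offSpineCoord-≤-spine lo<hi hi≤L (raised x≡) = ≤-trans (≤-reflexive x≡) (≤ᵥ-lookup (spine-mono lo<hi hi≤L) c)
    offSpineCoord-≤-spine _     _    (lowered _) = ≤-refl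
    offSpineCoord-≤-spine _     _    (kept _ x≤) = x≤

    spine-≤-offSpineCoord : ∀ {y} → lo < hi → hi ≤ L → OffSpineCoord x lo hi c y → lookup (s (suc lo)) c ≤ y
    spine-≤-offSpineCoord _     _    (raised x≡) = ≤-reflexive (sym x≡)
    spine-≤-offSpineCoord lo<hi hi≤L (lowered _) = ≤ᵥ-lookup (spine-mono lo<hi hi≤L) c
    spine-≤-offSpineCoord _     _    (kept ≤x _) = ≤x

  offSpineCoord : ∀ {x lo hi} (lo⋖ : s lo ⋖ s (suc lo)) (hi⋖ : s hi ⋖ s (suc hi)) →
    s lo ≤ᵥ x → x ≤ᵥ s (suc hi) →
    lookup x (dir lo⋖) ≡ lookup (s lo) (dir lo⋖) →
    lookup x (dir hi⋖) ≡ lookup (s (suc hi)) (dir hi⋖) →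
    dir lo⋖ ≢ dir hi⋖ →
    ∀ c → OffSpineCoord x lo hi c (lookup x c + Δ lo c ∸ Δ hi c)
  offSpineCoord {x} {lo} {hi} lo⋖ hi⋖ s[lo]≤x x≤s[1+hi] x[a]≡ x[b]≡ a≢b c
    with c ≟ dir lo⋖ | c ≟ dir hi⋖
  ... | yes refl | _ = subst (OffSpineCoord x lo hi c) (sym value)
          (raised (trans (cong suc x[a]≡) (sym (at-dir lo⋖))))
    where
    value : lookup x c + Δ lo c ∸ Δ hi c ≡ suc (lookup x c)
    value = trans (cong₂ (λ d e → lookup x c + d ∸ e) (⋖-∸-dir lo⋖) (⋖-∸-off hi⋖ c a≢b))
                  (+-comm (lookup x c) 1)
  ... | no c≢a | yes refl = subst (OffSpineCoord x lo hi c) (sym value)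
          (lowered (trans x[b]≡ (at-dir hi⋖)))
    where
    value : lookup x c + Δ lo c ∸ Δ hi c ≡ lookup (s hi) c
    value = begin
      lookup x c + Δ lo c ∸ Δ hi c  ≡⟨ cong₂ (λ d e → lookup x c + d ∸ e) (⋖-∸-off lo⋖ c c≢a) (⋖-∸-dir hi⋖) ⟩
      lookup x c + 0 ∸ 1            ≡⟨ cong (λ y → y + 0 ∸ 1) (trans x[b]≡ (at-dir hi⋖)) ⟩
      suc (lookup (s hi) c) + 0 ∸ 1 ≡⟨ +-identityʳ (lookup (s hi) c) ⟩
      lookup (s hi) c               ∎
      where open ≡-Reasoning
  ... | no c≢a | no c≢b = subst (OffSpineCoord x lo hi c) (sym value)
          (kept (≤-trans (≤-reflexive (off-dir lo⋖ c c≢a)) (≤ᵥ-lookup s[lo]≤x c))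
                (≤-trans (≤ᵥ-lookup x≤s[1+hi] c) (≤-reflexive (off-dir hi⋖ c c≢b))))
    where
    value : lookup x c + Δ lo c ∸ Δ hi c ≡ lookup x c
    value = trans (cong₂ (λ d e → lookup x c + d ∸ e) (⋖-∸-off lo⋖ c c≢a) (⋖-∸-off hi⋖ c c≢b))
                  (+-identityʳ (lookup x c))

  record OffSpine (x : Vertex k) : Set where
    field
      lo hi        : ℕ
      lo<hi        : lo < hi
      hi<L         : hi < L
      spine-lo-≤ᵥ  : s lo ≤ᵥ x
      ≤ᵥ-spine-1+hi : x ≤ᵥ s (suc hi)
      lo-greatest  : ∀ {i} → i ≤ L → s i ≤ᵥ x → i ≤ lo
      1+hi-least   : ∀ {i} → i ≤ L → x ≤ᵥ s i → suc hi ≤ i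
      coord        : ∀ c → OffSpineCoord x lo hi c (lookup (herringboneOff x) c)

  toOffSpine : ∀ {x} → InCube n x → (∀ i → i ≤ L → s i ≢ x) → OffSpine x
  toOffSpine {x} x∈ x∉s with M n k s x in M≡ | off-spine-gap x∉s μ-≤ M-≤ spine-μ-≤ᵥ (≤ᵥ-spine-M x∈)
  ... | zero   | ()
  ... | suc hi | s≤s 1+lo≤hi = record
    { lo = lo ; hi = hi ; lo<hi = 1+lo≤hi ; hi<L = hi<L
    ; spine-lo-≤ᵥ = spine-μ-≤ᵥ ; ≤ᵥ-spine-1+hi = x≤s[1+hi]
    ; lo-greatest = μ-greatest
    ; 1+hi-least = λ i≤L x≤s[i] → subst (_≤ _) M≡ (M-least i≤L x≤s[i])
    ; coord = λ c → subst (OffSpineCoord x lo hi c) (sym (lookup-herringboneOff c M≡))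
                      (offSpineCoord lo⋖ hi⋖ spine-μ-≤ᵥ x≤s[1+hi] x[a]≡ x[b]≡ a≢b c)
    }
    where
    lo : ℕ
    lo = μ n k s x
    hi<L : hi < L
    hi<L = subst (_≤ L) M≡ M-≤
    x≤s[1+hi] : x ≤ᵥ s (suc hi)
    x≤s[1+hi] = subst (λ i → x ≤ᵥ s i) M≡ (≤ᵥ-spine-M x∈)
    lo⋖ : s lo ⋖ s (suc lo)
    lo⋖ = spine-⋖ (<-trans 1+lo≤hi hi<L)
    hi⋖ : s hi ⋖ s (suc hi)
    hi⋖ = spine-⋖ hi<L
    x[a]≡ : lookup x (dir lo⋖) ≡ lookup (s lo) (dir lo⋖)
    x[a]≡ with lookup (s lo) (dir lo⋖) <? lookup x (dir lo⋖)
    ... | yes s[lo]<x = ⊥-elim (1+n≰n (μ-greatest (<-trans 1+lo≤hi hi<L) (⋖-above lo⋖ spine-μ-≤ᵥ s[lo]<x)))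
    ... | no  s[lo]≮x = ≤-antisym (≮⇒≥ s[lo]≮x) (≤ᵥ-lookup spine-μ-≤ᵥ (dir lo⋖))
    x[b]≡ : lookup x (dir hi⋖) ≡ lookup (s (suc hi)) (dir hi⋖)
    x[b]≡ with lookup x (dir hi⋖) <? lookup (s (suc hi)) (dir hi⋖)
    ... | yes x<s[1+hi] = ⊥-elim (1+n≰n (subst (_≤ hi) M≡ (M-least (<⇒≤ hi<L) (⋖-below hi⋖ x≤s[1+hi] x<s[1+hi]))))
    ... | no  x≮s[1+hi] = ≤-antisym (≤ᵥ-lookup x≤s[1+hi] (dir hi⋖)) (≮⇒≥ x≮s[1+hi])
    a≢b : dir lo⋖ ≢ dir hi⋖
    a≢b a≡b = <-irrefl x[a]≡s[1+hi][a] x[a]<s[1+hi][a]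
      where
      open ≤-Reasoning
      a : Fin k
      a = dir lo⋖
      x[a]≡s[1+hi][a] : lookup x a ≡ lookup (s (suc hi)) a
      x[a]≡s[1+hi][a] = subst (λ d → lookup x d ≡ lookup (s (suc hi)) d) (sym a≡b) x[b]≡
      x[a]<s[1+hi][a] : lookup x a < lookup (s (suc hi)) a
      x[a]<s[1+hi][a] = begin-strict
        lookup x a             ≡⟨ x[a]≡ ⟩
        lookup (s lo) a        <⟨ ≤-reflexive (sym (at-dir lo⋖)) ⟩
        lookup (s (suc lo)) a  ≤⟨ ≤ᵥ-lookup (spine-mono (s≤s (<⇒≤ 1+lo≤hi)) hi<L) a ⟩
        lookup (s (suc hi)) a  ∎

  module _ {x : Vertex k} (o : OffSpine x) where
    open OffSpine o

    herringboneOff-≤ᵥ-spine : herringboneOff x ≤ᵥ s hi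
    herringboneOff-≤ᵥ-spine = lookup⇒≤ᵥ λ c → offSpineCoord-≤-spine lo<hi (<⇒≤ hi<L) (coord c)

    spine-≤ᵥ-herringboneOff : s (suc lo) ≤ᵥ herringboneOff x
    spine-≤ᵥ-herringboneOff = lookup⇒≤ᵥ λ c → spine-≤-offSpineCoord lo<hi (<⇒≤ hi<L) (coord c)

  herringboneOff-mono : ∀ {v w} → OffSpine v → OffSpine w → v ≤ᵥ w → herringboneOff v ≤ᵥ herringboneOff w
  herringboneOff-mono {v} {w} ov ow v≤w = lookup⇒≤ᵥ λ c → compare c (V.coord c) (W.coord c)
    where
    module V = OffSpine ov
    module W = OffSpine ow
    hiᵛ≤hiʷ : V.hi ≤ W.hi
    hiᵛ≤hiʷ = ≤-pred (V.1+hi-least (W.hi<L) (≤ᵥ-trans v≤w W.≤ᵥ-spine-1+hi))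
    loᵛ≤loʷ : V.lo ≤ W.lo
    loᵛ≤loʷ = W.lo-greatest (<⇒≤ (<-trans V.lo<hi V.hi<L)) (≤ᵥ-trans V.spine-lo-≤ᵥ v≤w)
    compare : ∀ c {y y'} → OffSpineCoord v V.lo V.hi c y → OffSpineCoord w W.lo W.hi c y' → y ≤ y'
    compare c vc (raised _) = ≤-trans (offSpineCoord-≤-suc vc) (s≤s (≤ᵥ-lookup v≤w c))
    compare c vc (lowered _) = ≤-trans (offSpineCoord-≤-spine V.lo<hi (<⇒≤ V.hi<L) vc)
                                       (≤ᵥ-lookup (spine-mono hiᵛ≤hiʷ (<⇒≤ W.hi<L)) c)
    compare c vc (kept s≤w _) = offSpineCoord-≤ vc (≤ᵥ-lookup v≤w c)
      (≤-trans (≤ᵥ-lookup (spine-mono (s≤s loᵛ≤loʷ) (<-trans W.lo<hi W.hi<L)) c) s≤w)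

  View-mono : ∀ {j v w y y'} → j ≤ L → InCube n v → InCube n w → v ≤ᵥ w →
              View j v y → View j w y' → y ≤ᵥ y'
  View-mono j≤L _ _ v≤w (onSpine p≤L refl G) (onSpine p'≤L refl G') =
    spine-mono (stepToward-mono G G' (spine-index-mono p≤L p'≤L v≤w)) (stepToward-≤ j≤L p'≤L G')
  View-mono _ _ w∈ v≤w (onSpine p≤L refl G) (offSpine w∉s) =
    ≤ᵥ-trans (spine-mono (≤-trans (stepToward-≤-suc G) (s≤s (W.lo-greatest p≤L v≤w))) (<-trans W.lo<hi W.hi<L))
             (spine-≤ᵥ-herringboneOff ow)
    where
    ow : OffSpine _
    ow = toOffSpine w∈ w∉s
    module W = OffSpine ow
  View-mono j≤L v∈ _ v≤w (offSpine v∉s) (onSpine p'≤L refl G') =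
    ≤ᵥ-trans (herringboneOff-≤ᵥ-spine ov)
             (spine-mono (≤-trans (<⇒≤pred (V.1+hi-least p'≤L v≤w)) (pred-≤-stepToward G')) (stepToward-≤ j≤L p'≤L G'))
    where
    ov : OffSpine _
    ov = toOffSpine v∈ v∉s
    module V = OffSpine ov
  View-mono _ v∈ w∈ v≤w (offSpine v∉s) (offSpine w∉s) =
    herringboneOff-mono (toOffSpine v∈ v∉s) (toOffSpine w∈ w∉s) v≤w

lemma3 : (n k : ℕ) (s : ℕ → Vertex k) → IsSpine n k s →
         (j : ℕ) → j ≤ len n k →
         (v w : Vertex k) → InCube n v → InCube n w →
         v ≤ᵥ w → herringbone n k s j v ≤ᵥ herringbone n k s j w
lemma3 n k s spine j j≤L v w v∈ w∈ v≤w = View-mono j≤L v∈ w∈ v≤w (view j v) (view j w)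
  where open Spine spine
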